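{- Let $m, n$ be positive integers with $m \leq n < 3m+2$ and suppose $\gamma(Q_{m \times n}) = (m+n-2)/4$. Let $D$ be a minimum dominating set of $Q_{m \times n}$. Then $|D| \leq m-2$, every square of the box border $E$ of $D$ is covered by exactly one square of $D$ (i.e. exactly one square of $D$ shares a row, column, difference diagonal or sum diagonal with it), and $D$ is independent (no two squares of $D$ are adjacent in $Q_{m \times n}$).
   Context: The $m \times n$ chessboard has squares $(x,y)$ with $1 \le x \le n$ (column $x$) and $1 \le y \le m$ (row $y$). The queens graph $Q_{m \times n}$ has these squares as vertices; two distinct squares are adjacent if they lie in the same row, the same column, the same difference diagonal (same value of $y-x$) or the same sum diagonal (same value of $y+x$). A set $D$ of squares is a dominating set if every square is in $D$ or adjacent to a square of $D$; $\gamma(Q_{m \times n})$ denotes the minimum size of a dominating set. For a set $D$ of squares with $m \le n$ and $|D| \le m-2$ (so at least two rows and at least two columns contain no square of $D$), let $a$ and $b$ be the smallest and largest indices of columns containing no square of $D$, and $c$ and $d$ the smallest and largest indices of rows containing no square of $D$. The box of $D$ is the sub-board $U=\{(x,y): a \le x \le b,\ c \le y \le d\}$, and the box border $E$ of $D$ is the set of edge squares of $U$, i.e. the squares $(x,y)\in U$ with $x \in \{a,b\}$ or $y \in \{c,d\}$. -}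

module Defs where

open import Data.Nat using (ℕ; _+_; _*_; _∸_; _≤_; _<_)
open import Data.Product using (_×_; _,_; proj₁; proj₂; Σ; ∃; ∃-syntax)
open import Data.Sum using (_⊎_)
open import Data.List using (List; length)
open import Data.List.Membership.Propositional using (_∈_)
open import Data.List.Relation.Unary.Unique.Propositional using (Unique)
open import Relation.Binary.PropositionalEquality using (_≡_; _≢_)
open import Relation.Nullary using (¬_)

Square : Set
Square = ℕ × ℕ

col row : Square → ℕ
col = proj₁
row = proj₂

OnBoard : ℕ → ℕ → Square → Set
OnBoard m n (x , y) = (1 ≤ x × x ≤ n) × (1 ≤ y × y ≤ m)

-- same row, same column, same difference diagonal (y - x = y' - x',
-- written without truncated subtraction as y + x' = y' + x), or same sum diagonal.
-- (Reflexive: every square shares its own row.)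
ShareLine : Square → Square → Set
ShareLine (x , y) (x' , y') =
  x ≡ x' ⊎ y ≡ y' ⊎ (y + x' ≡ y' + x) ⊎ (y + x ≡ y' + x')

Adjacent : Square → Square → Set
Adjacent s t = s ≢ t × ShareLine s t

IsBoardSet : ℕ → ℕ → List Square → Set
IsBoardSet m n D = Unique D × (∀ {s} → s ∈ D → OnBoard m n s)

IsDominating : ℕ → ℕ → List Square → Set
IsDominating m n D =
  IsBoardSet m n D ×
  (∀ s → OnBoard m n s → s ∈ D ⊎ (∃[ t ] (t ∈ D × Adjacent t s)))

IsMinimumDominating : ℕ → ℕ → List Square → Set
IsMinimumDominating m n D =
  IsDominating m n D × (∀ D' → IsDominating m n D' → length D ≤ length D')

IsDominationNumber : ℕ → ℕ → ℕ → Set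
IsDominationNumber m n k =
  Σ (List Square) λ D → IsMinimumDominating m n D × length D ≡ k

Independent : List Square → Set
Independent D = ∀ {s t} → s ∈ D → t ∈ D → ¬ Adjacent s t

EmptyCol : ℕ → List Square → ℕ → Set
EmptyCol n D x = (1 ≤ x × x ≤ n) × (∀ {s} → s ∈ D → col s ≢ x)

EmptyRow : ℕ → List Square → ℕ → Set
EmptyRow m D y = (1 ≤ y × y ≤ m) × (∀ {s} → s ∈ D → row s ≢ y)

IsBoxBounds : ℕ → ℕ → List Square → ℕ → ℕ → ℕ → ℕ → Set
IsBoxBounds m n D a b c d =
  (EmptyCol n D a × (∀ x → EmptyCol n D x → a ≤ x)) ×
  (EmptyCol n D b × (∀ x → EmptyCol n D x → x ≤ b)) ×
  (EmptyRow m D c × (∀ y → EmptyRow m D y → c ≤ y)) ×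
  (EmptyRow m D d × (∀ y → EmptyRow m D y → y ≤ d))

InBoxBorder : ℕ → ℕ → ℕ → ℕ → Square → Set
InBoxBorder a b c d (x , y) =
  (a ≤ x × x ≤ b) × (c ≤ y × y ≤ d) ×
  (x ≡ a ⊎ x ≡ b ⊎ y ≡ c ⊎ y ≡ d)

CoveredExactlyOnce : List Square → Square → Set
CoveredExactlyOnce D s =
  ∃[ t ] ((t ∈ D × ShareLine t s) × (∀ {t'} → t' ∈ D → ShareLine t' s → t' ≡ t))

module Submission where

-- Write k = |D| and call a row or column vacant if it contains no square of D; there are at
-- least m − k vacant rows and n − k vacant columns. If k ≥ m − 1 then k = m − 1 (as
-- 4k + 2 = m + n < 4m + 2), some row is vacant, and since each queen covers at most three of its
-- squares, n ≤ 3k, i.e. m + n ≤ 4k + 1. Hence k ≤ m − 2.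
--
-- The box border squares lying in a vacant row and a vacant column can only be covered
-- diagonally. There are at least 2(m − k) + 2(n − k − 2) = 4k of them, while a diagonal meets
-- the border of a rectangle at most twice, so a queen covers at most four of them. Hence all
-- these counts are exact: each such square is covered exactly once, each diagonal of each queen
-- meets two of them, and no two queens share a row or a column. A further border square on a
-- queen's diagonal would be a third border point on it, so every other border square is covered
-- only along its one occupied line; and two queens on a common diagonal would both cover the
-- border squares of that diagonal.

open import Defs
open import Data.Nat using (ℕ; zero; suc; _+_; _*_; _∸_; _≤_; _<_; z≤n; s≤s; _≟_; _<?_)
open import Data.Nat.Properties
open import Data.Nat.Tactic.RingSolver using (solve-∀)
open import Algebra.Properties.CommutativeSemigroup +-commutativeSemigroup using (interchange)
open import Data.Product using (_×_; _,_; proj₁; proj₂; ∃-syntax)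
open import Data.Product.Properties using (≡-dec)
open import Data.Sum using (_⊎_; inj₁; inj₂; [_,_]′)
open import Data.Empty using (⊥; ⊥-elim)
open import Data.List using (List; []; _∷_; length; map; filter; applyUpTo; _++_)
open import Data.List.Properties using (length-map; length-++; length-applyUpTo)
open import Data.List.Relation.Unary.Any using (here; there)
import Data.List.Relation.Unary.All as All
open import Data.List.Relation.Unary.All.Properties using (¬Any⇒All¬)
open import Data.List.Relation.Unary.AllPairs using (_∷_)
open import Data.List.Relation.Unary.Unique.Propositional using (Unique)
import Data.List.Relation.Unary.Unique.Propositional.Properties as Unique
open import Data.List.Membership.Propositional using (_∈_; _∉_)
open import Data.List.Membership.Propositional.Properties
  using (∈-map⁺; ∈-map⁻; ∈-filter⁺; ∈-filter⁻; ∈-++⁻; ∈-applyUpTo⁺; ∈-applyUpTo⁻)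
open import Data.List.Relation.Binary.Subset.Propositional using (_⊆_)
open import Function using (id; _∘_; flip)
open import Data.List.Extrema.Nat using (min; max; argmin-sel; argmax-sel; min≤xs; xs≤max)
open import Relation.Nullary using (¬_; Dec; yes; no)
open import Relation.Nullary.Decidable using (¬?; _×-dec_; _⊎-dec_)
open import Relation.Unary using (Decidable)
open import Relation.Binary.Definitions using (DecidableEquality; tri<; tri≈; tri>)
open import Relation.Binary.PropositionalEquality
  using (_≡_; _≢_; refl; sym; trans; cong; cong₂; subst; subst₂; module ≡-Reasoning)

private
  variable
    A B : Set
    x y : A
    xs ys zs : List A
    Q R S : Set

∑ : List A → (A → ℕ) → ℕ
∑ []       f = 0
∑ (x ∷ xs) f = f x + ∑ xs f

syntax ∑ xs (λ x → e) = ∑[ x ∈ xs ] e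

∑-zero : (xs : List A) → ∑[ x ∈ xs ] 0 ≡ 0
∑-zero []       = refl
∑-zero (x ∷ xs) = ∑-zero xs

∑-const : (xs : List A) (c : ℕ) → ∑[ x ∈ xs ] c ≡ length xs * c
∑-const []       c = refl
∑-const (x ∷ xs) c = cong (c +_) (∑-const xs c)

∑-1 : (xs : List A) → ∑[ x ∈ xs ] 1 ≡ length xs
∑-1 xs = trans (∑-const xs 1) (*-identityʳ _)

∑-+ : (xs : List A) (f g : A → ℕ) → ∑[ x ∈ xs ] (f x + g x) ≡ ∑ xs f + ∑ xs g
∑-+ []       f g = refl
∑-+ (x ∷ xs) f g =
  trans (cong (f x + g x +_) (∑-+ xs f g)) (interchange (f x) (g x) (∑ xs f) (∑ xs g))

∑-comm : (xs : List A) (ys : List B) (f : A → B → ℕ) →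
         ∑[ x ∈ xs ] ∑[ y ∈ ys ] f x y ≡ ∑[ y ∈ ys ] ∑[ x ∈ xs ] f x y
∑-comm []       ys f = sym (∑-zero ys)
∑-comm (x ∷ xs) ys f =
  trans (cong (∑ ys (f x) +_) (∑-comm xs ys f)) (sym (∑-+ ys (f x) _))

∑-cong : (xs : List A) {f g : A → ℕ} → (∀ {x} → x ∈ xs → f x ≡ g x) → ∑ xs f ≡ ∑ xs g
∑-cong []       f≡g = refl
∑-cong (x ∷ xs) f≡g = cong₂ _+_ (f≡g (here refl)) (∑-cong xs (f≡g ∘ there))

∑-mono-≤ : (xs : List A) {f g : A → ℕ} → (∀ {x} → x ∈ xs → f x ≤ g x) → ∑ xs f ≤ ∑ xs g
∑-mono-≤ []       f≤g = z≤n
∑-mono-≤ (x ∷ xs) f≤g = +-mono-≤ (f≤g (here refl)) (∑-mono-≤ xs (f≤g ∘ there))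

∈⇒≤∑ : (f : A → ℕ) → x ∈ xs → f x ≤ ∑ xs f
∈⇒≤∑ f (here refl)         = m≤m+n _ _
∈⇒≤∑ {xs = y ∷ _} f (there x∈) = ≤-trans (∈⇒≤∑ f x∈) (m≤n+m _ (f y))

1≤∑⇒∃ : (xs : List A) (f : A → ℕ) → 1 ≤ ∑ xs f → ∃[ x ] (x ∈ xs × 1 ≤ f x)
1≤∑⇒∃ (x ∷ xs) f 1≤∑ with f x in eq
... | suc _ = x , here refl , subst (1 ≤_) (sym eq) (s≤s z≤n)
... | zero  with y , y∈ , 1≤fy ← 1≤∑⇒∃ xs f 1≤∑ = y , there y∈ , 1≤fy

2≤∑ : (f : A → ℕ) → Unique xs → x ∈ xs → y ∈ xs → x ≢ y → 1 ≤ f x → 1 ≤ f y → 2 ≤ ∑ xs f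
2≤∑ f u           (here refl) (here refl) x≢y _ _ = ⊥-elim (x≢y refl)
2≤∑ f u           (here refl) (there y∈)  _ 1≤fx 1≤fy = +-mono-≤ 1≤fx (≤-trans 1≤fy (∈⇒≤∑ f y∈))
2≤∑ {xs = z ∷ zs} f u (there x∈) (here refl) _ 1≤fx 1≤fy =
  subst (2 ≤_) (+-comm (∑ zs f) (f z)) (+-mono-≤ (≤-trans 1≤fx (∈⇒≤∑ f x∈)) 1≤fy)
2≤∑ {xs = z ∷ zs} f (_ ∷ u) (there x∈) (there y∈) x≢y 1≤fx 1≤fy =
  ≤-trans (2≤∑ f u x∈ y∈ x≢y 1≤fx 1≤fy) (m≤n+m _ (f z))

∑-tight : (xs : List A) {f g : A → ℕ} → (∀ {x} → x ∈ xs → f x ≤ g x) → ∑ xs g ≤ ∑ xs f →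
          ∀ {x} → x ∈ xs → f x ≡ g x
∑-tight (x ∷ xs) {f} {g} f≤g ∑g≤∑f = λ where
    (here refl) → ≤-antisym (f≤g (here refl)) gx≤fx
    (there x∈)  → ∑-tight xs (f≤g ∘ there) ∑g≤∑f′ x∈
  where
  gx≤fx : g x ≤ f x
  gx≤fx = +-cancelʳ-≤ (∑ xs g) (g x) (f x)
            (≤-trans ∑g≤∑f (+-monoʳ-≤ (f x) (∑-mono-≤ xs (f≤g ∘ there))))
  ∑g≤∑f′ : ∑ xs g ≤ ∑ xs f
  ∑g≤∑f′ = +-cancelˡ-≤ (g x) (∑ xs g) (∑ xs f)
             (≤-trans ∑g≤∑f (+-monoˡ-≤ (∑ xs f) (f≤g (here refl))))

𝟙 : {Q : Set} → Dec Q → ℕ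
𝟙 (yes _) = 1
𝟙 (no _)  = 0

1≤𝟙 : (q : Dec Q) → Q → 1 ≤ 𝟙 q
1≤𝟙 (yes _) _  = ≤-refl
1≤𝟙 (no ¬q)  q = ⊥-elim (¬q q)

1≤𝟙⇒ : (q : Dec Q) → 1 ≤ 𝟙 q → Q
1≤𝟙⇒ (yes q) _ = q

𝟙-mono : (Q → R) → (q : Dec Q) (r : Dec R) → 𝟙 q ≤ 𝟙 r
𝟙-mono Q⇒R (yes q) r      = 1≤𝟙 r (Q⇒R q)
𝟙-mono Q⇒R (no _)  r      = z≤n

𝟙-⊎ : (Q → R ⊎ S) → (q : Dec Q) (r : Dec R) (s : Dec S) → 𝟙 q ≤ 𝟙 r + 𝟙 s
𝟙-⊎ split (no _)  r s = z≤n
𝟙-⊎ split (yes q) r s with split q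
... | inj₁ x = ≤-trans (1≤𝟙 r x) (m≤m+n _ _)
... | inj₂ x = ≤-trans (1≤𝟙 s x) (m≤n+m _ _)

𝟙-¬ : (q : Dec Q) → 𝟙 q + 𝟙 (¬? q) ≡ 1
𝟙-¬ (yes _) = refl
𝟙-¬ (no _)  = refl

module _ {xs : List A} {ys : List B} (f : A → B → ℕ) (c : ℕ)
         (covered : ∀ {x} → x ∈ xs → 1 ≤ ∑[ y ∈ ys ] f x y)
         (bounded : ∀ {y} → y ∈ ys → ∑[ x ∈ xs ] f x y ≤ c) where

  private
    ∑-covered≤ : ∑[ x ∈ xs ] ∑[ y ∈ ys ] f x y ≤ length ys * c
    ∑-covered≤ = begin
      ∑[ x ∈ xs ] ∑[ y ∈ ys ] f x y ≡⟨ ∑-comm xs ys f ⟩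
      ∑[ y ∈ ys ] ∑[ x ∈ xs ] f x y ≤⟨ ∑-mono-≤ ys bounded ⟩
      ∑[ y ∈ ys ] c                 ≡⟨ ∑-const ys c ⟩
      length ys * c                 ∎
      where open ≤-Reasoning

    length≤∑-covered : length xs ≤ ∑[ x ∈ xs ] ∑[ y ∈ ys ] f x y
    length≤∑-covered = begin
      length xs                     ≡⟨ ∑-1 xs ⟨
      ∑[ x ∈ xs ] 1                 ≤⟨ ∑-mono-≤ xs covered ⟩
      ∑[ x ∈ xs ] ∑[ y ∈ ys ] f x y ∎
      where open ≤-Reasoning

  double-count : length xs ≤ length ys * c
  double-count = ≤-trans length≤∑-covered ∑-covered≤

  double-count-tight : length ys * c ≤ length xs →
    (∀ {x} → x ∈ xs → ∑[ y ∈ ys ] f x y ≡ 1) × (∀ {y} → y ∈ ys → ∑[ x ∈ xs ] f x y ≡ c)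
  double-count-tight tight =
    (λ x∈ → sym (∑-tight xs covered
                   (≤-trans ∑-covered≤ (≤-trans tight (≤-reflexive (sym (∑-1 xs))))) x∈)) ,
    ∑-tight ys bounded
      (≤-trans (≤-reflexive (∑-const ys c)) (≤-trans tight (≤-trans length≤∑-covered
        (≤-reflexive (∑-comm xs ys f)))))

no-three-distinct-keys : {Q : A → Set} (key : A → ℕ) →
  (∀ {x y z} → Q x → Q y → Q z → key x < key y → key y < key z → ⊥) →
  ∀ {x y z} → Q x → Q y → Q z → key x ≢ key y → key y ≢ key z → key x ≢ key z → ⊥
no-three-distinct-keys key increasing {x} {y} {z} qx qy qz x≢y y≢z x≢z
  with <-cmp (key x) (key y) | <-cmp (key y) (key z) | <-cmp (key x) (key z)
... | tri≈ _ e _ | _          | _          = x≢y e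
... | _          | tri≈ _ e _ | _          = y≢z e
... | _          | _          | tri≈ _ e _ = x≢z e
... | tri< x<y _ _ | tri< y<z _ _ | _            = increasing qx qy qz x<y y<z
... | tri< x<y _ _ | tri> _ _ z<y | tri< x<z _ _ = increasing qx qz qy x<z z<y
... | tri< x<y _ _ | tri> _ _ z<y | tri> _ _ z<x = increasing qz qx qy z<x x<y
... | tri> _ _ y<x | tri< y<z _ _ | tri< x<z _ _ = increasing qy qx qz y<x x<z
... | tri> _ _ y<x | tri< y<z _ _ | tri> _ _ z<x = increasing qy qz qx y<z z<x
... | tri> _ _ y<x | tri> _ _ z<y | _            = increasing qz qy qx z<y y<x

count : {P : A → Set} → Decidable P → List A → ℕ
count P? xs = ∑[ x ∈ xs ] 𝟙 (P? x)

module _ {P : A → Set} (P? : Decidable P) where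

  count-none : (xs : List A) → (∀ {x} → x ∈ xs → ¬ P x) → count P? xs ≡ 0
  count-none []       none = refl
  count-none (x ∷ xs) none with P? x
  ... | yes px = ⊥-elim (none (here refl) px)
  ... | no _   = count-none xs (none ∘ there)

  count-≤1 : Unique xs → (∀ {x y} → x ∈ xs → y ∈ xs → P x → P y → x ≡ y) → count P? xs ≤ 1
  count-≤1 {[]}     _          _   = z≤n
  count-≤1 {x ∷ xs} (x∉ ∷ u) same with P? x
  ... | no _   = count-≤1 u (λ y∈ z∈ → same (there y∈) (there z∈))
  ... | yes px = ≤-reflexive (cong suc (count-none xs λ y∈ py →
                   All.lookup x∉ y∈ (same (here refl) (there y∈) px py)))

  count-≤2 : (key : A → ℕ) → Unique xs →
             (∀ {x y} → P x → P y → key x ≡ key y → x ≡ y) →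
             (∀ {x y z} → x ∈ xs → y ∈ xs → z ∈ xs → P x → P y → P z →
                key x < key y → key y < key z → ⊥) →
             count P? xs ≤ 2
  count-≤2 {[]}     key _        _   _          = z≤n
  count-≤2 {x ∷ xs} key (x∉ ∷ u) inj increasing with P? x
  ... | no _   = count-≤2 key u inj λ x∈ y∈ z∈ → increasing (there x∈) (there y∈) (there z∈)
  ... | yes px = s≤s (count-≤1 u same)
    where
    apart : ∀ {y} → y ∈ xs → P y → key x ≢ key y
    apart y∈ py eq = All.lookup x∉ y∈ (inj px py eq)
    same : ∀ {y z} → y ∈ xs → z ∈ xs → P y → P z → y ≡ z
    same {y} {z} y∈ z∈ py pz with key y ≟ key z
    ... | yes eq = inj py pz eq
    ... | no  ne = ⊥-elim (no-three-distinct-keys {Q = λ w → w ∈ x ∷ xs × P w} key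
          (λ (x∈ , px) (y∈ , py) (z∈ , pz) → increasing x∈ y∈ z∈ px py pz)
          (here refl , px) (there y∈ , py) (there z∈ , pz) (apart y∈ py) ne (apart z∈ pz))

  count-¬ : (xs : List A) → count P? xs + count (¬? ∘ P?) xs ≡ length xs
  count-¬ xs = begin
    count P? xs + count (¬? ∘ P?) xs        ≡⟨ ∑-+ xs (𝟙 ∘ P?) (𝟙 ∘ ¬? ∘ P?) ⟨
    ∑[ x ∈ xs ] (𝟙 (P? x) + 𝟙 (¬? (P? x))) ≡⟨ ∑-cong xs (λ {x} _ → 𝟙-¬ (P? x)) ⟩
    ∑[ x ∈ xs ] 1                           ≡⟨ ∑-1 xs ⟩
    length xs                               ∎
    where open ≡-Reasoning

  length-filter : (xs : List A) → length (filter P? xs) ≡ count P? xs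
  length-filter []       = refl
  length-filter (x ∷ xs) with P? x
  ... | yes _ = cong suc (length-filter xs)
  ... | no _  = length-filter xs

module Pigeonhole {A : Set} (_≟ᴬ_ : DecidableEquality A) where

  open import Data.List.Membership.DecPropositional _≟ᴬ_ using (_∈?_; _∉?_)

  private
    ∈⇒∷⊆ : y ∈ ys → y ∷ ys ⊆ ys
    ∈⇒∷⊆ y∈ (here refl) = y∈
    ∈⇒∷⊆ y∈ (there x∈)  = x∈

  occupied-⊆ : (L : List A) → ys ⊆ zs → count (_∈? ys) L ≤ count (_∈? zs) L
  occupied-⊆ {ys} {zs} L ys⊆zs = ∑-mono-≤ L λ {x} _ → 𝟙-mono ys⊆zs (x ∈? ys) (x ∈? zs)

  occupied-∷ : {L : List A} → Unique L → count (_∈? y ∷ ys) L ≤ suc (count (_∈? ys) L)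
  occupied-∷ {y} {ys} {L} u = begin
    count (_∈? y ∷ ys) L                     ≤⟨ ∑-mono-≤ L (λ {x} _ → 𝟙-⊎ split (x ∈? y ∷ ys) (x ≟ᴬ y) (x ∈? ys)) ⟩
    ∑[ x ∈ L ] (𝟙 (x ≟ᴬ y) + 𝟙 (x ∈? ys))   ≡⟨ ∑-+ L _ _ ⟩
    count (_≟ᴬ y) L + count (_∈? ys) L      ≤⟨ +-monoˡ-≤ _ (count-≤1 (_≟ᴬ y) u λ _ _ e e′ → trans e (sym e′)) ⟩
    suc (count (_∈? ys) L)                   ∎
    where
    open ≤-Reasoning
    split : x ∈ y ∷ ys → x ≡ y ⊎ x ∈ ys
    split (here e)  = inj₁ e
    split (there p) = inj₂ p

  occupied-≤ : {L : List A} → Unique L → count (_∈? ys) L ≤ length ys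
  occupied-≤ {[]}     {L} u = ≤-reflexive (count-none (_∈? []) L λ _ ())
  occupied-≤ {y ∷ ys} {L} u = ≤-trans (occupied-∷ u) (s≤s (occupied-≤ u))

  occupied-< : {L : List A} {t t′ : B} (f : B → A) → Unique L → t ∈ xs → t′ ∈ xs → t ≢ t′ → f t ≡ f t′ →
               suc (count (_∈? map f xs) L) ≤ length xs
  occupied-< f u (here refl) (here refl) t≢t′ _ = ⊥-elim (t≢t′ refl)
  occupied-< {xs = _ ∷ xs} {L = L} f u (here refl) (there t′∈) _ e =
    s≤s (≤-trans (occupied-⊆ L (∈⇒∷⊆ (subst (_∈ map f xs) (sym e) (∈-map⁺ f t′∈))))
                 (≤-trans (occupied-≤ u) (≤-reflexive (length-map f xs))))
  occupied-< {xs = _ ∷ xs} {L = L} f u (there t∈) (here refl) _ e =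
    s≤s (≤-trans (occupied-⊆ L (∈⇒∷⊆ (subst (_∈ map f xs) e (∈-map⁺ f t∈))))
                 (≤-trans (occupied-≤ u) (≤-reflexive (length-map f xs))))
  occupied-< f u (there t∈) (there t′∈) t≢t′ e =
    ≤-trans (s≤s (occupied-∷ u)) (s≤s (occupied-< f u t∈ t′∈ t≢t′ e))

  vacant-count : {L : List A} → Unique L → length L ≤ count (_∉? ys) L + length ys
  vacant-count {ys = ys} {L = L} u = begin
    length L                             ≡⟨ count-¬ (_∈? ys) L ⟨
    count (_∈? ys) L + count (_∉? ys) L ≤⟨ +-monoˡ-≤ _ (occupied-≤ u) ⟩
    length ys + count (_∉? ys) L        ≡⟨ +-comm (length ys) _ ⟩
    count (_∉? ys) L + length ys        ∎
    where open ≤-Reasoning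

  vacant-count-< : {L : List A} {t t′ : B} (f : B → A) → Unique L → t ∈ xs → t′ ∈ xs → t ≢ t′ → f t ≡ f t′ →
                   suc (length L) ≤ count (_∉? map f xs) L + length xs
  vacant-count-< {xs = xs} {L = L} f u t∈ t′∈ t≢t′ e = begin
    suc (length L)                                       ≡⟨ cong suc (count-¬ (_∈? map f xs) L) ⟨
    suc (count (_∈? map f xs) L + count (_∉? map f xs) L) ≤⟨ +-monoˡ-≤ _ (occupied-< f u t∈ t′∈ t≢t′ e) ⟩
    length xs + count (_∉? map f xs) L                   ≡⟨ +-comm (length xs) _ ⟩
    count (_∉? map f xs) L + length xs                   ∎
    where open ≤-Reasoning

indices : ℕ → List ℕ
indices = applyUpTo suc

∈-indices⁺ : ∀ {i n} → 1 ≤ i → i ≤ n → i ∈ indices n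
∈-indices⁺ {suc i} _ i<n = ∈-applyUpTo⁺ suc i<n

∈-indices⁻ : ∀ {i n} → i ∈ indices n → 1 ≤ i × i ≤ n
∈-indices⁻ i∈ with j , j<n , refl ← ∈-applyUpTo⁻ suc i∈ = s≤s z≤n , j<n

length-indices : ∀ n → length (indices n) ≡ n
length-indices = length-applyUpTo suc

indices-unique : ∀ n → Unique (indices n)
indices-unique n = Unique.applyUpTo⁺₁ suc n (λ i<j _ → <⇒≢ i<j ∘ suc-injective)

_≟ˢ_ : DecidableEquality Square
_≟ˢ_ = ≡-dec _≟_ _≟_

data Direction : Set where
  ascending descending : Direction

OnDiagonal : Direction → Square → Square → Set
OnDiagonal ascending  q s = row q + col s ≡ row s + col q
OnDiagonal descending q s = row q + col q ≡ row s + col s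

onDiagonal? : ∀ δ q s → Dec (OnDiagonal δ q s)
onDiagonal? ascending  q s = row q + col s ≟ row s + col q
onDiagonal? descending q s = row q + col q ≟ row s + col s

Attack : Square → Square → Set
Attack t s = col t ≡ col s ⊎ row t ≡ row s ⊎ ∃[ δ ] OnDiagonal δ t s

share-line-cases : ∀ t s → ShareLine t s → Attack t s
share-line-cases t s (inj₁ e)                 = inj₁ e
share-line-cases t s (inj₂ (inj₁ e))          = inj₂ (inj₁ e)
share-line-cases t s (inj₂ (inj₂ (inj₁ e)))   = inj₂ (inj₂ (ascending , e))
share-line-cases t s (inj₂ (inj₂ (inj₂ e)))   = inj₂ (inj₂ (descending , e))

RowsOrdered : Direction → ℕ → ℕ → Set
RowsOrdered ascending  y y′ = y < y′
RowsOrdered descending y y′ = y′ < y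

module _ {q p p′ : Square} where

  diagonal-rows-ordered : ∀ δ → OnDiagonal δ q p → OnDiagonal δ q p′ → col p < col p′ →
                          RowsOrdered δ (row p) (row p′)
  diagonal-rows-ordered ascending  e e′ x<x′ =
    +-cancelʳ-< (col q) (row p) (row p′) (subst₂ _<_ e e′ (+-monoʳ-< (row q) x<x′))
  diagonal-rows-ordered descending e e′ x<x′ =
    ≰⇒> λ y≤y′ → <⇒≢ (+-mono-≤-< y≤y′ x<x′) (trans (sym e) e′)

  diagonal-col-injective : ∀ δ → OnDiagonal δ q p → OnDiagonal δ q p′ → col p ≡ col p′ → p ≡ p′
  diagonal-col-injective ascending  e e′ x≡x′ = cong₂ _,_ x≡x′
    (+-cancelʳ-≡ (col q) (row p) (row p′) (trans (sym e) (trans (cong (row q +_) x≡x′) e′)))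
  diagonal-col-injective descending e e′ x≡x′ = cong₂ _,_ x≡x′
    (+-cancelʳ-≡ (col p′) (row p) (row p′) (trans (cong (row p +_) (sym x≡x′)) (trans (sym e) e′)))

  diagonal-row-injective : ∀ δ → OnDiagonal δ q p → OnDiagonal δ q p′ → row p ≡ row p′ → p ≡ p′
  diagonal-row-injective ascending  e e′ y≡y′ = flip (cong₂ _,_) y≡y′
    (+-cancelˡ-≡ (row q) (col p) (col p′) (trans e (trans (cong (_+ col q) y≡y′) (sym e′))))
  diagonal-row-injective descending e e′ y≡y′ = flip (cong₂ _,_) y≡y′
    (+-cancelˡ-≡ (row p′) (col p) (col p′) (trans (cong (_+ col p) (sym y≡y′)) (trans (sym e) e′)))

diagonal-trans : ∀ δ {q t e} → OnDiagonal δ q t → OnDiagonal δ q e → OnDiagonal δ t e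
diagonal-trans ascending  {q} {t} {e} q~t q~e = +-cancelʳ-≡ (row q + col t) (row t + col e) (row e + col t) (begin
  row t + col e + (row q + col t) ≡⟨ shuffle (row t) (col e) (row q) (col t) ⟩
  row q + col e + (row t + col t) ≡⟨ cong (_+ (row t + col t)) q~e ⟩
  row e + col q + (row t + col t) ≡⟨ shuffle (row e) (col q) (row t) (col t) ⟩
  row t + col q + (row e + col t) ≡⟨ cong (_+ (row e + col t)) q~t ⟨
  row q + col t + (row e + col t) ≡⟨ +-comm (row q + col t) (row e + col t) ⟩
  row e + col t + (row q + col t) ∎)
  where
  open ≡-Reasoning
  shuffle : ∀ w x y z → w + x + (y + z) ≡ y + x + (w + z)
  shuffle = solve-∀
diagonal-trans descending q~t q~e = trans (sym q~t) q~e

border-no-monotone-triple : ∀ {a b c d} δ {p₁ p₂ p₃} →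
  InBoxBorder a b c d p₁ → InBoxBorder a b c d p₂ → InBoxBorder a b c d p₃ →
  col p₁ < col p₂ → col p₂ < col p₃ →
  RowsOrdered δ (row p₁) (row p₂) → RowsOrdered δ (row p₂) (row p₃) → ⊥
border-no-monotone-triple δ ((a≤x₁ , _) , (c≤y₁ , y₁≤d) , _) (_ , _ , side) ((_ , x₃≤b) , (c≤y₃ , y₃≤d) , _)
  x₁<x₂ x₂<x₃ y₁~y₂ y₂~y₃ = on-side δ side y₁~y₂ y₂~y₃
  where
  on-side : ∀ δ → _ → RowsOrdered δ _ _ → RowsOrdered δ _ _ → ⊥
  on-side _          (inj₁ x₂≡a)               _     _     = <⇒≢ (≤-<-trans a≤x₁ x₁<x₂) (sym x₂≡a)
  on-side _          (inj₂ (inj₁ x₂≡b))        _     _     = <⇒≢ (<-≤-trans x₂<x₃ x₃≤b) x₂≡b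
  on-side ascending  (inj₂ (inj₂ (inj₁ y₂≡c))) y₁<y₂ _     = <⇒≢ (≤-<-trans c≤y₁ y₁<y₂) (sym y₂≡c)
  on-side descending (inj₂ (inj₂ (inj₁ y₂≡c))) _     y₃<y₂ = <⇒≢ (≤-<-trans c≤y₃ y₃<y₂) (sym y₂≡c)
  on-side ascending  (inj₂ (inj₂ (inj₂ y₂≡d))) _     y₂<y₃ = <⇒≢ (<-≤-trans y₂<y₃ y₃≤d) y₂≡d
  on-side descending (inj₂ (inj₂ (inj₂ y₂≡d))) y₂<y₁ _     = <⇒≢ (<-≤-trans y₂<y₁ y₁≤d) y₂≡d

border-diagonal-≤2 : ∀ {a b c d} δ q {L} → Unique L → (∀ {s} → s ∈ L → InBoxBorder a b c d s) →
                     count (onDiagonal? δ q) L ≤ 2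
border-diagonal-≤2 δ q unique border = count-≤2 (onDiagonal? δ q) col unique
  (diagonal-col-injective δ)
  λ p₁∈ p₂∈ p₃∈ q~p₁ q~p₂ q~p₃ x₁<x₂ x₂<x₃ →
    border-no-monotone-triple δ (border p₁∈) (border p₂∈) (border p₃∈) x₁<x₂ x₂<x₃
      (diagonal-rows-ordered δ q~p₁ q~p₂ x₁<x₂) (diagonal-rows-ordered δ q~p₂ q~p₃ x₂<x₃)

diagonal-hits : Square → Square → ℕ
diagonal-hits q s = 𝟙 (onDiagonal? ascending q s) + 𝟙 (onDiagonal? descending q s)

on-diagonal⇒1≤hits : ∀ δ {q s} → OnDiagonal δ q s → 1 ≤ diagonal-hits q s
on-diagonal⇒1≤hits ascending  {q} {s} q~s = ≤-trans (1≤𝟙 (onDiagonal? ascending q s) q~s) (m≤m+n _ _)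
on-diagonal⇒1≤hits descending {q} {s} q~s = ≤-trans (1≤𝟙 (onDiagonal? descending q s) q~s) (m≤n+m _ _)

box-arith : ∀ {m n k R C e₁ e₂} → 4 * k + 2 ≤ m + n → m + e₁ ≤ R + k → n + e₂ ≤ (C + 2) + k →
            4 * k + 2 * (e₁ + e₂) ≤ R + (R + (C + C))
box-arith {m} {n} {k} {R} {C} {e₁} {e₂} bound rows cols = +-cancelʳ-≤ (4 * k + 4) _ _ (begin
  4 * k + 2 * (e₁ + e₂) + (4 * k + 4) ≡⟨ regroup₁ k (e₁ + e₂) ⟩
  2 * (4 * k + 2) + 2 * (e₁ + e₂)     ≤⟨ +-monoˡ-≤ _ (*-monoʳ-≤ 2 bound) ⟩
  2 * (m + n) + 2 * (e₁ + e₂)         ≡⟨ regroup₂ m n e₁ e₂ ⟩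
  2 * (m + e₁) + 2 * (n + e₂)         ≤⟨ +-mono-≤ (*-monoʳ-≤ 2 rows) (*-monoʳ-≤ 2 cols) ⟩
  2 * (R + k) + 2 * (C + 2 + k)       ≡⟨ regroup₃ R C k ⟩
  R + (R + (C + C)) + (4 * k + 4)     ∎)
  where
  open ≤-Reasoning
  regroup₁ : ∀ k e → 4 * k + 2 * e + (4 * k + 4) ≡ 2 * (4 * k + 2) + 2 * e
  regroup₁ = solve-∀
  regroup₂ : ∀ m n e₁ e₂ → 2 * (m + n) + 2 * (e₁ + e₂) ≡ 2 * (m + e₁) + 2 * (n + e₂)
  regroup₂ = solve-∀
  regroup₃ : ∀ R C k → 2 * (R + k) + 2 * (C + 2 + k) ≡ R + (R + (C + C)) + (4 * k + 4)
  regroup₃ = solve-∀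

module Domination {m n : ℕ} {D : List Square} (dominating : IsDominating m n D) where

  open import Data.List.Membership.DecPropositional _≟_ using (_∉?_)
  open import Data.List.Membership.DecPropositional _≟ˢ_ using () renaming (_∈?_ to _∈ˢ?_)
  open Pigeonhole _≟_ using (vacant-count; vacant-count-<)

  Vacant : (Square → ℕ) → ℕ → Set
  Vacant line i = i ∉ map line D

  vacant? : ∀ line i → Dec (Vacant line i)
  vacant? line i = i ∉? map line D

  vacant⇒≢ : ∀ {line i t} → Vacant line i → t ∈ D → line t ≢ i
  vacant⇒≢ {line} vacant t∈ refl = vacant (∈-map⁺ line t∈)

  ≢⇒vacant : ∀ {line i} → (∀ {t} → t ∈ D → line t ≢ i) → Vacant line i
  ≢⇒vacant ≢ i∈ with t , t∈ , refl ← ∈-map⁻ _ i∈ = ≢ t∈ refl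

  Open : Square → Set
  Open s = Vacant row (row s) × Vacant col (col s)

  dominated : ∀ {s} → OnBoard m n s → ∃[ t ] (t ∈ D × ShareLine t s)
  dominated {s} on-board with proj₂ dominating s on-board
  ... | inj₁ s∈                   = s , s∈ , inj₁ refl
  ... | inj₂ (t , t∈ , _ , t~s) = t , t∈ , t~s

  open-dominated : ∀ {s} → OnBoard m n s → Open s → ∃[ t ] (t ∈ D × ∃[ δ ] OnDiagonal δ t s)
  open-dominated {s} on-board (row-vacant , col-vacant)
    with t , t∈ , t~s ← dominated on-board
    with share-line-cases t s t~s
  ... | inj₁ same-col           = ⊥-elim (vacant⇒≢ col-vacant t∈ same-col)
  ... | inj₂ (inj₁ same-row)    = ⊥-elim (vacant⇒≢ row-vacant t∈ same-row)
  ... | inj₂ (inj₂ diagonal)    = t , t∈ , diagonal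

  vacant-lines : ∀ line N → N ≤ count (vacant? line) (indices N) + length D
  vacant-lines line N =
    subst₂ _≤_ (length-indices N) (cong (count (vacant? line) (indices N) +_) (length-map line D))
               (vacant-count (indices-unique N))

  shared-line⇒vacant-lines : ∀ line N {t t′} → t ∈ D → t′ ∈ D → t ≢ t′ → line t ≡ line t′ →
                             suc N ≤ count (vacant? line) (indices N) + length D
  shared-line⇒vacant-lines line N t∈ t′∈ t≢t′ same =
    subst₂ _≤_ (cong suc (length-indices N)) refl (vacant-count-< line (indices-unique N) t∈ t′∈ t≢t′ same)

  vacant-row⇒n≤3|D| : ∀ {y} → y ∈ indices m → Vacant row y → n ≤ length D * 3
  vacant-row⇒n≤3|D| {y} y∈ vacant =
    subst (_≤ length D * 3) (length-indices n) (double-count attacks 3 covered bounded)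
    where
    attacks : ℕ → Square → ℕ
    attacks x q = 𝟙 (col q ≟ x) + diagonal-hits q (x , y)

    covered : ∀ {x} → x ∈ indices n → 1 ≤ ∑[ q ∈ D ] attacks x q
    covered {x} x∈ with t , t∈ , t~s ← dominated (∈-indices⁻ x∈ , ∈-indices⁻ y∈) =
      ≤-trans (attack (share-line-cases t (x , y) t~s)) (∈⇒≤∑ (attacks x) t∈)
      where
      attack : Attack t (x , y) → 1 ≤ attacks x t
      attack (inj₁ same-col)          = ≤-trans (1≤𝟙 (col t ≟ x) same-col) (m≤m+n _ _)
      attack (inj₂ (inj₁ same-row))   = ⊥-elim (vacant⇒≢ vacant t∈ same-row)
      attack (inj₂ (inj₂ (δ , t~s))) = ≤-trans (on-diagonal⇒1≤hits δ t~s) (m≤n+m _ (𝟙 (col t ≟ x)))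

    once-on-row : ∀ δ q → count (λ x → onDiagonal? δ q (x , y)) (indices n) ≤ 1
    once-on-row δ q = count-≤1 _ (indices-unique n) λ _ _ q~s q~s′ →
      cong proj₁ (diagonal-row-injective δ q~s q~s′ refl)

    bounded : ∀ {q} → q ∈ D → ∑[ x ∈ indices n ] attacks x q ≤ 3
    bounded {q} _ = begin
      ∑[ x ∈ indices n ] attacks x q
        ≡⟨ ∑-+ (indices n) _ _ ⟩
      count (col q ≟_) (indices n) + ∑[ x ∈ indices n ] diagonal-hits q (x , y)
        ≡⟨ cong (count (col q ≟_) (indices n) +_) (∑-+ (indices n) _ _) ⟩
      count (col q ≟_) (indices n) + (count (λ x → onDiagonal? ascending q (x , y)) (indices n)
                                      + count (λ x → onDiagonal? descending q (x , y)) (indices n))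
        ≤⟨ +-mono-≤ (count-≤1 _ (indices-unique n) λ _ _ e e′ → trans (sym e) e′)
                    (+-mono-≤ (once-on-row ascending q) (once-on-row descending q)) ⟩
      3 ∎
      where open ≤-Reasoning

  2+|D|≤m : n < 3 * m + 2 → 4 * length D + 2 ≤ m + n → 2 + length D ≤ m
  2+|D|≤m n<3m+2 bound with m ≤? length D
  ... | yes m≤k = ⊥-elim (too-many m≤k)
    where
    too-many : m ≤ length D → ⊥
    too-many m≤k = <-irrefl refl (begin-strict
      4 * length D + 2 ≤⟨ bound ⟩
      m + n            <⟨ +-monoʳ-< m n<3m+2 ⟩
      m + (3 * m + 2)  ≡⟨ regroup m ⟩
      4 * m + 2        ≤⟨ +-monoˡ-≤ 2 (*-monoʳ-≤ 4 m≤k) ⟩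
      4 * length D + 2 ∎)
      where
      open ≤-Reasoning
      regroup : ∀ m → m + (3 * m + 2) ≡ 4 * m + 2
      regroup = solve-∀
  ... | no m≰k with suc (length D) ≟ m
  ...   | no  k+1≢m = ≤∧≢⇒< (≰⇒> m≰k) k+1≢m
  ...   | yes refl
    with y₀ , y₀∈ , 1≤𝟙 ← 1≤∑⇒∃ (indices m) (𝟙 ∘ vacant? row) (+-cancelʳ-≤ (length D) 1 _ (vacant-lines row m))
    = ⊥-elim (<-irrefl refl (begin-strict
      4 * length D + 2              ≤⟨ bound ⟩
      suc (length D) + n            ≤⟨ +-monoʳ-≤ m (vacant-row⇒n≤3|D| y₀∈ (1≤𝟙⇒ (vacant? row y₀) 1≤𝟙)) ⟩
      suc (length D) + length D * 3 ≡⟨ regroup (length D) ⟩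
      4 * length D + 1              <⟨ +-monoʳ-< (4 * length D) ≤-refl ⟩
      4 * length D + 2              ∎))
    where
    open ≤-Reasoning
    regroup : ∀ k → suc k + k * 3 ≡ 4 * k + 1
    regroup = solve-∀

  EmptyLine : (Square → ℕ) → ℕ → ℕ → Set
  EmptyLine line N i = (1 ≤ i × i ≤ N) × (∀ {s} → s ∈ D → line s ≢ i)

  record Extremes (line : Square → ℕ) (N lo hi : ℕ) : Set where
    field
      lo-empty    : EmptyLine line N lo
      lo-least    : ∀ i → EmptyLine line N i → lo ≤ i
      hi-empty    : EmptyLine line N hi
      hi-greatest : ∀ i → EmptyLine line N i → i ≤ hi

    lo-vacant : Vacant line lo
    lo-vacant = ≢⇒vacant (proj₂ lo-empty)

    hi-vacant : Vacant line hi
    hi-vacant = ≢⇒vacant (proj₂ hi-empty)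

    1≤lo : 1 ≤ lo
    1≤lo = proj₁ (proj₁ lo-empty)

    hi≤N : hi ≤ N
    hi≤N = proj₂ (proj₁ hi-empty)

    vacant-within : ∀ {i} → i ∈ indices N → Vacant line i → lo ≤ i × i ≤ hi
    vacant-within {i} i∈ vacant = lo-least _ empty , hi-greatest _ empty
      where
      empty : EmptyLine line N i
      empty = ∈-indices⁻ i∈ , λ {_} → vacant⇒≢ vacant

    lo≤hi : lo ≤ hi
    lo≤hi = lo-least hi hi-empty

    lo≢hi : 2 + length D ≤ N → lo ≢ hi
    lo≢hi room refl = <-irrefl refl (begin-strict
      N                                            ≤⟨ vacant-lines line N ⟩
      count (vacant? line) (indices N) + length D  ≤⟨ +-monoˡ-≤ (length D) at-most-one ⟩
      1 + length D                                 <⟨ room ⟩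
      N                                            ∎)
      where
      open ≤-Reasoning
      at-most-one : count (vacant? line) (indices N) ≤ 1
      at-most-one = count-≤1 _ (indices-unique N) λ i∈ j∈ vi vj →
        trans (≤-antisym (proj₂ (vacant-within i∈ vi)) (proj₁ (vacant-within i∈ vi)))
              (sym (≤-antisym (proj₂ (vacant-within j∈ vj)) (proj₁ (vacant-within j∈ vj))))

  box-bounds⇒extremes : ∀ {a b c d} → IsBoxBounds m n D a b c d → Extremes col n a b × Extremes row m c d
  box-bounds⇒extremes ((a-empty , a-least) , (b-empty , b-greatest) , (c-empty , c-least) , (d-empty , d-greatest)) =
    record { lo-empty = a-empty ; lo-least = a-least ; hi-empty = b-empty ; hi-greatest = b-greatest } ,
    record { lo-empty = c-empty ; lo-least = c-least ; hi-empty = d-empty ; hi-greatest = d-greatest }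

  extremes : ∀ line N → 2 + length D ≤ N → ∃[ lo ] ∃[ hi ] Extremes line N lo hi
  extremes line N room
    with i , i∈ , 1≤𝟙 ← 1≤∑⇒∃ (indices N) (𝟙 ∘ vacant? line) (+-cancelʳ-≤ (length D) 1 _
                          (≤-trans (m≤n+m _ 1) (≤-trans room (vacant-lines line N))))
    = min i V , max i V , record
      { lo-empty    = [ (λ e → subst (EmptyLine line N) (sym e) (empty i∈V)) , empty ]′ (argmin-sel id i V)
      ; lo-least    = λ _ e → All.lookup (min≤xs i V) (member e)
      ; hi-empty    = [ (λ e → subst (EmptyLine line N) (sym e) (empty i∈V)) , empty ]′ (argmax-sel id i V)
      ; hi-greatest = λ _ e → All.lookup (xs≤max i V) (member e)
      }
    where
    V : List ℕ
    V = filter (vacant? line) (indices N)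
    empty : ∀ {j} → j ∈ V → EmptyLine line N j
    empty j∈ with j∈ᴺ , vacant ← ∈-filter⁻ (vacant? line) j∈ = ∈-indices⁻ j∈ᴺ , λ {_} → vacant⇒≢ vacant
    member : ∀ {j} → EmptyLine line N j → j ∈ V
    member ((1≤j , j≤N) , ≢) = ∈-filter⁺ (vacant? line) (∈-indices⁺ 1≤j j≤N) (≢⇒vacant ≢)
    i∈V : i ∈ V
    i∈V = ∈-filter⁺ (vacant? line) i∈ (1≤𝟙⇒ (vacant? line i) 1≤𝟙)

  module Box {a b c d : ℕ} (cols : Extremes col n a b) (rows : Extremes row m c d)
             (room : 2 + length D ≤ m) (m≤n : m ≤ n) (bound : 4 * length D + 2 ≤ m + n) where

    private
      module C = Extremes cols
      module R = Extremes rows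

    InnerVacantCol : ℕ → Set
    InnerVacantCol x = Vacant col x × a < x × x < b

    innerVacantCol? : Decidable InnerVacantCol
    innerVacantCol? x = vacant? col x ×-dec a <? x ×-dec x <? b

    vacantRows innerVacantCols : List ℕ
    vacantRows      = filter (vacant? row) (indices m)
    innerVacantCols = filter innerVacantCol? (indices n)

    -- The border squares whose row and column are both vacant; corners are listed on the sides a, b only.
    openBorder : List Square
    openBorder = map (a ,_) vacantRows ++ map (b ,_) vacantRows ++
                 map (_, c) innerVacantCols ++ map (_, d) innerVacantCols

    border⇒on-board : ∀ {s} → InBoxBorder a b c d s → OnBoard m n s
    border⇒on-board ((a≤x , x≤b) , (c≤y , y≤d) , _) =
      (≤-trans C.1≤lo a≤x , ≤-trans x≤b C.hi≤N) , (≤-trans R.1≤lo c≤y , ≤-trans y≤d R.hi≤N)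

    border-vacant : ∀ {s} → InBoxBorder a b c d s → Vacant col (col s) ⊎ Vacant row (row s)
    border-vacant (_ , _ , inj₁ refl)                 = inj₁ C.lo-vacant
    border-vacant (_ , _ , inj₂ (inj₁ refl))          = inj₁ C.hi-vacant
    border-vacant (_ , _ , inj₂ (inj₂ (inj₁ refl)))   = inj₂ R.lo-vacant
    border-vacant (_ , _ , inj₂ (inj₂ (inj₂ refl)))   = inj₂ R.hi-vacant

    vertical-side : ∀ {x y} → x ≡ a ⊎ x ≡ b → y ∈ vacantRows → InBoxBorder a b c d (x , y) × Open (x , y)
    vertical-side {x} {y} side y∈ with y∈ᴺ , vacant ← ∈-filter⁻ (vacant? row) {xs = indices m} y∈ =
      (x-range side , R.vacant-within y∈ᴺ vacant , [ inj₁ , inj₂ ∘ inj₁ ]′ side) , vacant , x-vacant side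
      where
      x-range : x ≡ a ⊎ x ≡ b → a ≤ x × x ≤ b
      x-range (inj₁ refl) = ≤-refl , C.lo≤hi
      x-range (inj₂ refl) = C.lo≤hi , ≤-refl
      x-vacant : x ≡ a ⊎ x ≡ b → Vacant col x
      x-vacant (inj₁ refl) = C.lo-vacant
      x-vacant (inj₂ refl) = C.hi-vacant

    horizontal-side : ∀ {x y} → y ≡ c ⊎ y ≡ d → x ∈ innerVacantCols → InBoxBorder a b c d (x , y) × Open (x , y)
    horizontal-side {x} {y} side x∈ with _ , vacant , a<x , x<b ← ∈-filter⁻ innerVacantCol? {xs = indices n} x∈ =
      ((<⇒≤ a<x , <⇒≤ x<b) , y-range side , inj₂ (inj₂ side)) , y-vacant side , vacant
      where
      y-range : y ≡ c ⊎ y ≡ d → c ≤ y × y ≤ d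
      y-range (inj₁ refl) = ≤-refl , R.lo≤hi
      y-range (inj₂ refl) = R.lo≤hi , ≤-refl
      y-vacant : y ≡ c ⊎ y ≡ d → Vacant row y
      y-vacant (inj₁ refl) = R.lo-vacant
      y-vacant (inj₂ refl) = R.hi-vacant

    openBorder-sound : ∀ {s} → s ∈ openBorder → InBoxBorder a b c d s × Open s
    openBorder-sound s∈ with ∈-++⁻ (map (a ,_) vacantRows) s∈
    ... | inj₁ s∈a with _ , y∈ , refl ← ∈-map⁻ (a ,_) s∈a = vertical-side (inj₁ refl) y∈
    ... | inj₂ s∈′ with ∈-++⁻ (map (b ,_) vacantRows) s∈′
    ...   | inj₁ s∈b with _ , y∈ , refl ← ∈-map⁻ (b ,_) s∈b = vertical-side (inj₂ refl) y∈
    ...   | inj₂ s∈″ with ∈-++⁻ (map (_, c) innerVacantCols) s∈″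
    ...     | inj₁ s∈c with _ , x∈ , refl ← ∈-map⁻ (_, c) s∈c = horizontal-side (inj₁ refl) x∈
    ...     | inj₂ s∈d with _ , x∈ , refl ← ∈-map⁻ (_, d) s∈d = horizontal-side (inj₂ refl) x∈

    private
      col-at : ∀ {s x ys} → s ∈ map (x ,_) ys → col s ≡ x
      col-at s∈ with _ , _ , refl ← ∈-map⁻ _ s∈ = refl

      row-at : ∀ {s y xs} → s ∈ map (_, y) xs → row s ≡ y
      row-at s∈ with _ , _ , refl ← ∈-map⁻ _ s∈ = refl

      inner : ∀ {s} → s ∈ map (_, c) innerVacantCols ++ map (_, d) innerVacantCols → a < col s × col s < b
      inner {s} s∈ = [ at-inner , at-inner ]′ (∈-++⁻ (map (_, c) innerVacantCols) s∈)
        where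
        at-inner : ∀ {y} → s ∈ map (_, y) innerVacantCols → a < col s × col s < b
        at-inner s∈ with _ , x∈ , refl ← ∈-map⁻ _ s∈ =
          proj₂ (proj₂ (∈-filter⁻ innerVacantCol? {xs = indices n} x∈))

    openBorder-unique : Unique openBorder
    openBorder-unique =
      Unique.++⁺ (Unique.map⁺ (cong proj₂) rows-unique)
        (Unique.++⁺ (Unique.map⁺ (cong proj₂) rows-unique)
          (Unique.++⁺ (Unique.map⁺ (cong proj₁) cols-unique) (Unique.map⁺ (cong proj₁) cols-unique)
            λ (s∈c , s∈d) → R.lo≢hi room (trans (sym (row-at s∈c)) (row-at s∈d)))
          λ (s∈b , s∈cd) → <⇒≢ (proj₂ (inner s∈cd)) (col-at s∈b))
        λ (s∈a , s∈bcd) → [ (λ s∈b → C.lo≢hi (≤-trans room m≤n) (trans (sym (col-at s∈a)) (col-at s∈b)))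
                           , (λ s∈cd → <⇒≢ (proj₁ (inner s∈cd)) (sym (col-at s∈a))) ]′
                           (∈-++⁻ (map (b ,_) vacantRows) s∈bcd)
      where
      rows-unique : Unique vacantRows
      rows-unique = Unique.filter⁺ (vacant? row) (indices-unique m)
      cols-unique : Unique innerVacantCols
      cols-unique = Unique.filter⁺ innerVacantCol? (indices-unique n)

    length-openBorder :
      length openBorder ≡ count (vacant? row) (indices m) + (count (vacant? row) (indices m) +
                          (count innerVacantCol? (indices n) + count innerVacantCol? (indices n)))
    length-openBorder =
      trans (length-++ (map (a ,_) vacantRows)) (cong₂ _+_ (side (a ,_) vacantRows rows-filtered)
      (trans (length-++ (map (b ,_) vacantRows)) (cong₂ _+_ (side (b ,_) vacantRows rows-filtered)
      (trans (length-++ (map (_, c) innerVacantCols)) (cong₂ _+_ (side (_, c) innerVacantCols cols-filtered)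
                                                                (side (_, d) innerVacantCols cols-filtered))))))
      where
      side : ∀ {k} (f : ℕ → Square) xs → length xs ≡ k → length (map f xs) ≡ k
      side f xs = trans (length-map f xs)
      rows-filtered : length vacantRows ≡ count (vacant? row) (indices m)
      rows-filtered = length-filter (vacant? row) (indices m)
      cols-filtered : length innerVacantCols ≡ count innerVacantCol? (indices n)
      cols-filtered = length-filter innerVacantCol? (indices n)

    vacant-cols≤inner+2 : count (vacant? col) (indices n) ≤ count innerVacantCol? (indices n) + 2
    vacant-cols≤inner+2 = begin
      count (vacant? col) (indices n)
        ≤⟨ ∑-mono-≤ (indices n) (λ {x} x∈ → 𝟙-⊎ (classify x∈) (vacant? col x) (innerVacantCol? x) (x ≟ a ⊎-dec x ≟ b)) ⟩
      ∑[ x ∈ indices n ] (𝟙 (innerVacantCol? x) + 𝟙 (x ≟ a ⊎-dec x ≟ b))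
        ≡⟨ ∑-+ (indices n) _ _ ⟩
      count innerVacantCol? (indices n) + count (λ x → x ≟ a ⊎-dec x ≟ b) (indices n)
        ≤⟨ +-monoʳ-≤ _ (∑-mono-≤ (indices n) λ {x} _ → 𝟙-⊎ id (x ≟ a ⊎-dec x ≟ b) (x ≟ a) (x ≟ b)) ⟩
      count innerVacantCol? (indices n) + ∑[ x ∈ indices n ] (𝟙 (x ≟ a) + 𝟙 (x ≟ b))
        ≡⟨ cong (count innerVacantCol? (indices n) +_) (∑-+ (indices n) _ _) ⟩
      count innerVacantCol? (indices n) + (count (_≟ a) (indices n) + count (_≟ b) (indices n))
        ≤⟨ +-monoʳ-≤ _ (+-mono-≤ (at-most-once a) (at-most-once b)) ⟩
      count innerVacantCol? (indices n) + 2 ∎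
      where
      open ≤-Reasoning
      classify : ∀ {x} → x ∈ indices n → Vacant col x → InnerVacantCol x ⊎ (x ≡ a ⊎ x ≡ b)
      classify x∈ vacant with C.vacant-within x∈ vacant
      ... | a≤x , x≤b with m≤n⇒m<n∨m≡n a≤x | m≤n⇒m<n∨m≡n x≤b
      ...   | inj₂ a≡x | _        = inj₂ (inj₁ (sym a≡x))
      ...   | inj₁ _   | inj₂ x≡b = inj₂ (inj₂ x≡b)
      ...   | inj₁ a<x | inj₁ x<b = inj₁ (vacant , a<x , x<b)
      at-most-once : ∀ z → count (_≟ z) (indices n) ≤ 1
      at-most-once z = count-≤1 _ (indices-unique n) λ _ _ e e′ → trans e (sym e′)

    openBorder-≥ : ∀ {e₁ e₂} →
      m + e₁ ≤ count (vacant? row) (indices m) + length D →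
      n + e₂ ≤ count (vacant? col) (indices n) + length D →
      4 * length D + 2 * (e₁ + e₂) ≤ length openBorder
    openBorder-≥ rows≥ cols≥ = subst (_ ≤_) (sym length-openBorder)
      (box-arith {m} {n} {R = count (vacant? row) (indices m)} {C = count innerVacantCol? (indices n)}
        bound rows≥ (≤-trans cols≥ (+-monoˡ-≤ (length D) vacant-cols≤inner+2)))

    coverage : Square → ℕ
    coverage s = ∑[ q ∈ D ] diagonal-hits q s

    border-hits : Square → ℕ
    border-hits q = ∑[ s ∈ openBorder ] diagonal-hits q s

    open-border-covered : ∀ {s} → s ∈ openBorder → 1 ≤ coverage s
    open-border-covered {s} s∈ with border , open′ ← openBorder-sound s∈
      with t , t∈ , δ , t~s ← open-dominated (border⇒on-board border) open′ =
      ≤-trans (on-diagonal⇒1≤hits δ t~s) (∈⇒≤∑ (λ q → diagonal-hits q s) t∈)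

    border-hits≡ : ∀ q → border-hits q ≡ count (onDiagonal? ascending q) openBorder
                                      + count (onDiagonal? descending q) openBorder
    border-hits≡ q = ∑-+ openBorder _ _

    diagonal-≤2 : ∀ δ q → count (onDiagonal? δ q) openBorder ≤ 2
    diagonal-≤2 δ q = border-diagonal-≤2 δ q openBorder-unique (proj₁ ∘ openBorder-sound)

    border-hits≤4 : ∀ {q} → q ∈ D → border-hits q ≤ 4
    border-hits≤4 {q} _ =
      ≤-trans (≤-reflexive (border-hits≡ q)) (+-mono-≤ (diagonal-≤2 ascending q) (diagonal-≤2 descending q))

    openBorder-≤ : length openBorder ≤ length D * 4
    openBorder-≤ = double-count (flip diagonal-hits) 4 open-border-covered border-hits≤4

    no-excess : ∀ {e₁ e₂} →
      m + e₁ ≤ count (vacant? row) (indices m) + length D →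
      n + e₂ ≤ count (vacant? col) (indices n) + length D →
      1 ≤ e₁ + e₂ → ⊥
    no-excess {e₁} {e₂} rows≥ cols≥ 1≤e = <⇒≱ (begin-strict
      length D * 4                     ≡⟨ *-comm (length D) 4 ⟩
      4 * length D                     <⟨ m<m+n (4 * length D) (≤-trans (s≤s z≤n) (*-monoʳ-≤ 2 1≤e)) ⟩
      4 * length D + 2 * (e₁ + e₂)     ≤⟨ openBorder-≥ rows≥ cols≥ ⟩
      length openBorder                ∎) openBorder-≤
      where open ≤-Reasoning

    private
      rows≥ : m + 0 ≤ count (vacant? row) (indices m) + length D
      rows≥ = ≤-trans (≤-reflexive (+-identityʳ m)) (vacant-lines row m)

      cols≥ : n + 0 ≤ count (vacant? col) (indices n) + length D
      cols≥ = ≤-trans (≤-reflexive (+-identityʳ n)) (vacant-lines col n)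

    row-injective : ∀ {t t′} → t ∈ D → t′ ∈ D → row t ≡ row t′ → t ≡ t′
    row-injective {t} {t′} t∈ t′∈ same with t ≟ˢ t′
    ... | yes t≡t′ = t≡t′
    ... | no  t≢t′ = ⊥-elim (no-excess
          (≤-trans (≤-reflexive (+-comm m 1)) (shared-line⇒vacant-lines row m t∈ t′∈ t≢t′ same)) cols≥ ≤-refl)

    col-injective : ∀ {t t′} → t ∈ D → t′ ∈ D → col t ≡ col t′ → t ≡ t′
    col-injective {t} {t′} t∈ t′∈ same with t ≟ˢ t′
    ... | yes t≡t′ = t≡t′
    ... | no  t≢t′ = ⊥-elim (no-excess
          rows≥ (≤-trans (≤-reflexive (+-comm n 1)) (shared-line⇒vacant-lines col n t∈ t′∈ t≢t′ same)) ≤-refl)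

    private
      tight : length D * 4 ≤ length openBorder
      tight = ≤-trans (≤-reflexive (trans (*-comm (length D) 4) (sym (+-identityʳ _)))) (openBorder-≥ rows≥ cols≥)

    coverage≡1 : ∀ {s} → s ∈ openBorder → coverage s ≡ 1
    coverage≡1 = proj₁ (double-count-tight (flip diagonal-hits) 4 open-border-covered border-hits≤4 tight)

    border-hits≡4 : ∀ {q} → q ∈ D → border-hits q ≡ 4
    border-hits≡4 = proj₂ (double-count-tight (flip diagonal-hits) 4 open-border-covered border-hits≤4 tight)

    diagonal-≥2 : ∀ δ {q} → q ∈ D → 2 ≤ count (onDiagonal? δ q) openBorder
    diagonal-≥2 ascending {q} q∈ = +-cancelʳ-≤ 2 2 _ (begin
      4                                                   ≡⟨ trans (sym (border-hits≡ q)) (border-hits≡4 q∈) ⟨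
      count (onDiagonal? ascending q) openBorder
        + count (onDiagonal? descending q) openBorder     ≤⟨ +-monoʳ-≤ _ (diagonal-≤2 descending q) ⟩
      count (onDiagonal? ascending q) openBorder + 2      ∎)
      where open ≤-Reasoning
    diagonal-≥2 descending {q} q∈ = +-cancelˡ-≤ 2 2 _ (begin
      4                                                   ≡⟨ trans (sym (border-hits≡ q)) (border-hits≡4 q∈) ⟨
      count (onDiagonal? ascending q) openBorder
        + count (onDiagonal? descending q) openBorder     ≤⟨ +-monoˡ-≤ _ (diagonal-≤2 ascending q) ⟩
      2 + count (onDiagonal? descending q) openBorder     ∎)
      where open ≤-Reasoning

    diagonal-attack⇒open-border : ∀ δ {q s} → q ∈ D → InBoxBorder a b c d s → OnDiagonal δ q s → s ∈ openBorder
    diagonal-attack⇒open-border δ {q} {s} q∈ border q~s with s ∈ˢ? openBorder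
    ... | yes s∈ = s∈
    ... | no  s∉ = ⊥-elim (≤⇒≯
          (border-diagonal-≤2 δ q (¬Any⇒All¬ openBorder s∉ ∷ openBorder-unique) on-border)
          (+-mono-≤ (1≤𝟙 (onDiagonal? δ q s) q~s) (diagonal-≥2 δ q∈)))
      where
      on-border : ∀ {s′} → s′ ∈ s ∷ openBorder → InBoxBorder a b c d s′
      on-border (here refl) = border
      on-border (there s′∈) = proj₁ (openBorder-sound s′∈)

    open-border-attackers : ∀ {δ δ′ s u v} → s ∈ openBorder → u ∈ D → v ∈ D →
                            OnDiagonal δ u s → OnDiagonal δ′ v s → u ≡ v
    open-border-attackers {δ} {δ′} {s} {u} {v} s∈ u∈ v∈ u~s v~s with u ≟ˢ v
    ... | yes u≡v = u≡v
    ... | no  u≢v = ⊥-elim (≤⇒≯ (≤-reflexive (coverage≡1 s∈))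
          (2≤∑ (λ q → diagonal-hits q s) (proj₁ (proj₁ dominating)) u∈ v∈ u≢v
               (on-diagonal⇒1≤hits δ u~s) (on-diagonal⇒1≤hits δ′ v~s)))

    unique-attacker : ∀ {s u v} → InBoxBorder a b c d s → u ∈ D → v ∈ D → ShareLine u s → ShareLine v s → u ≡ v
    unique-attacker {s} {u} {v} border u∈ v∈ u~s v~s =
      attackers (share-line-cases u s u~s) (share-line-cases v s v~s)
      where
      open-if : ∀ {δ w} → w ∈ D → OnDiagonal δ w s → Open s
      open-if w∈ w~s = proj₂ (openBorder-sound (diagonal-attack⇒open-border _ w∈ border w~s))

      not-orthogonal : ∀ {w} → w ∈ D → Open s → col w ≡ col s ⊎ row w ≡ row s → ⊥
      not-orthogonal w∈ (_ , col-vacant) (inj₁ same-col) = vacant⇒≢ col-vacant w∈ same-col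
      not-orthogonal w∈ (row-vacant , _) (inj₂ same-row) = vacant⇒≢ row-vacant w∈ same-row

      not-crossing : ∀ {w w′} → w ∈ D → w′ ∈ D → col w ≡ col s → row w′ ≡ row s → ⊥
      not-crossing w∈ w′∈ same-col same-row with border-vacant border
      ... | inj₁ col-vacant = vacant⇒≢ col-vacant w∈ same-col
      ... | inj₂ row-vacant = vacant⇒≢ row-vacant w′∈ same-row

      attackers : Attack u s → Attack v s → u ≡ v
      attackers (inj₂ (inj₂ (_ , u~s))) (inj₂ (inj₂ (_ , v~s))) =
        open-border-attackers (diagonal-attack⇒open-border _ u∈ border u~s) u∈ v∈ u~s v~s
      attackers (inj₂ (inj₂ (_ , u~s))) (inj₁ same-col)        = ⊥-elim (not-orthogonal v∈ (open-if u∈ u~s) (inj₁ same-col))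
      attackers (inj₂ (inj₂ (_ , u~s))) (inj₂ (inj₁ same-row)) = ⊥-elim (not-orthogonal v∈ (open-if u∈ u~s) (inj₂ same-row))
      attackers (inj₁ same-col)        (inj₂ (inj₂ (_ , v~s))) = ⊥-elim (not-orthogonal u∈ (open-if v∈ v~s) (inj₁ same-col))
      attackers (inj₂ (inj₁ same-row)) (inj₂ (inj₂ (_ , v~s))) = ⊥-elim (not-orthogonal u∈ (open-if v∈ v~s) (inj₂ same-row))
      attackers (inj₁ same-col)        (inj₁ same-col′)        = col-injective u∈ v∈ (trans same-col (sym same-col′))
      attackers (inj₂ (inj₁ same-row)) (inj₂ (inj₁ same-row′)) = row-injective u∈ v∈ (trans same-row (sym same-row′))
      attackers (inj₁ same-col)        (inj₂ (inj₁ same-row))  = ⊥-elim (not-crossing u∈ v∈ same-col same-row)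
      attackers (inj₂ (inj₁ same-row)) (inj₁ same-col)         = ⊥-elim (not-crossing v∈ u∈ same-col same-row)

    covered-once : ∀ {s} → InBoxBorder a b c d s → CoveredExactlyOnce D s
    covered-once border with t , t∈ , t~s ← dominated (border⇒on-board border) =
      t , (t∈ , t~s) , λ t′∈ t′~s → unique-attacker border t′∈ t∈ t′~s t~s

    independent : Independent D
    independent {s} {t} s∈ t∈ (s≢t , s~t) with share-line-cases s t s~t
    ... | inj₁ same-col         = s≢t (col-injective s∈ t∈ same-col)
    ... | inj₂ (inj₁ same-row)  = s≢t (row-injective s∈ t∈ same-row)
    ... | inj₂ (inj₂ (δ , s~t))
      with e , e∈ , 1≤𝟙 ← 1≤∑⇒∃ openBorder (𝟙 ∘ onDiagonal? δ s) (≤-trans (s≤s z≤n) (diagonal-≥2 δ s∈))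
      = s≢t (open-border-attackers e∈ s∈ t∈ s~e (diagonal-trans δ s~t s~e))
      where
      s~e : OnDiagonal δ s e
      s~e = 1≤𝟙⇒ (onDiagonal? δ s e) 1≤𝟙

  independent : 2 + length D ≤ m → m ≤ n → 4 * length D + 2 ≤ m + n → Independent D
  independent room m≤n bound =
    Box.independent (proj₂ (proj₂ (extremes col n (≤-trans room m≤n))))
                    (proj₂ (proj₂ (extremes row m room))) room m≤n bound

corollary3 : (m n k : ℕ) → 1 ≤ m → m ≤ n → n < 3 * m + 2 →
    IsDominationNumber m n k → 4 * k + 2 ≡ m + n →
    (D : List Square) → IsMinimumDominating m n D →
    (length D ≤ m ∸ 2) ×
    (∀ a b c d → IsBoxBounds m n D a b c d →
      ∀ s → InBoxBorder a b c d s → CoveredExactlyOnce D s) ×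
    Independent D
corollary3 m n _ _ m≤n n<3m+2 (D₀ , (dominating₀ , _) , refl) γ-bound D (dominating , minimum) =
  m+n≤o⇒m≤o∸n (length D) (≤-trans (≤-reflexive (+-comm (length D) 2)) room) ,
  (λ a b c d bounds _ border →
    let (cols , rows) = box-bounds⇒extremes bounds in Box.covered-once cols rows room m≤n bound border) ,
  independent room m≤n bound
  where
  open Domination dominating
  bound : 4 * length D + 2 ≤ m + n
  bound = ≤-trans (+-monoˡ-≤ 2 (*-monoʳ-≤ 4 (minimum D₀ dominating₀))) (≤-reflexive γ-bound)
  room : 2 + length D ≤ m
  room = 2+|D|≤m n<3m+2 bound
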